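{- Let $G_1\subsetneq G_2\subsetneq\dots\subsetneq G_r$ be a sequence of distinct graphs on a common finite vertex set, each contained in the next (as edge sets), and let $i\ge 1$ with $3i\le r$. Then the following three conditions cannot all hold simultaneously: (1) there is some $j$ with $3i-1<j\le r$ such that $G_j\setminus G_{3i-2}$ is a clique; (2) there are some $k$ with $3i-1<k\le r$ and some $\ell$ with $1\le \ell<3i-1$ such that $G_k\setminus G_{3i-1}$ and $G_{3i-1}\setminus G_\ell$ are both cliques; (3) there is some $m$ with $1\le m<3i-1$ such that $G_{3i}\setminus G_m$ is a clique.
   Context: Graphs are simple graphs on a common vertex set, identified with their edge sets; $G\subset H$ means the edge set of $G$ is contained in that of $H$, and $H\setminus G$ denotes the set of edges of $H$ not in $G$. A set of edges $E$ is called a clique if there is a set $S$ of at least two vertices such that $E$ is exactly the set of all pairs of distinct vertices of $S$. -}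

module Defs where

open import Data.Nat using (ℕ; suc; _≤_; _<_)
open import Data.Fin using (Fin)
open import Data.Bool using (Bool; true; false; _∧_; not)
open import Data.Product using (_×_; ∃-syntax; Σ)
open import Relation.Binary.PropositionalEquality using (_≡_; _≢_)
open import Relation.Nullary using (¬_)

record Graph (n : ℕ) : Set where
  field
    adj    : Fin n → Fin n → Bool
    sym    : ∀ u v → adj u v ≡ adj v u
    irrefl : ∀ u → adj u u ≡ false
open Graph public

-- An edge set on Fin n: membership of the unordered pair {u,v} (u ≢ v).
EdgeSet : ℕ → Set
EdgeSet n = Fin n → Fin n → Bool

edges : ∀ {n} → Graph n → EdgeSet n
edges G = adj G

_⊆G_ : ∀ {n} → Graph n → Graph n → Set
G ⊆G H = ∀ u v → adj G u v ≡ true → adj H u v ≡ true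

_⊊G_ : ∀ {n} → Graph n → Graph n → Set
G ⊊G H = (G ⊆G H) × ¬ (H ⊆G G)

_∖G_ : ∀ {n} → Graph n → Graph n → EdgeSet n
(H ∖G G) u v = adj H u v ∧ not (adj G u v)

-- E is a clique: there is a set S of at least two vertices such that E is
-- exactly the set of pairs of distinct vertices of S.
IsClique : ∀ {n} → EdgeSet n → Set
IsClique {n} E = Σ (Fin n → Bool) λ S → (
    (∃[ a ] ∃[ b ] (a ≢ b × S a ≡ true × S b ≡ true))
  × (∀ (u v : Fin n) → u ≢ v → (E u v ≡ true → (S u ≡ true × S v ≡ true))
                    × ((S u ≡ true × S v ≡ true) → E u v ≡ true)))

module Submission where

open import Defs hiding (sym)
open import Data.Nat using (ℕ; suc; _≤_; _<_; _*_; _∸_; s≤s; z<s; _≤′_; ≤′-refl; ≤′-step)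
open import Data.Nat.Properties using (≤-trans; <⇒≤; ≤⇒≤′; ≤′⇒≤; <⇒≤pred; *-monoʳ-≤)
open import Data.Fin using (Fin)
open import Data.Bool using (Bool; true; false)
open import Data.Bool.Properties using (¬-not)
open import Data.Product using (_×_; ∃-syntax; _,_; proj₁; proj₂)
open import Data.Empty using (⊥; ⊥-elim)
open import Relation.Nullary using (¬_)
open import Relation.Binary.PropositionalEquality using (_≡_; refl; trans; sym; _≢_)

-- Write p, q, s for 3i-2, 3i-1, 3i and S, T, U, W for the vertex
-- sets of the cliques G_j∖G_p, G_k∖G_q, G_q∖G_l, G_s∖G_m. Take a new edge ab of
-- G_s (not in G_q) and a new edge cd of G_q (not in G_p). Then a, b ∈ S ∩ T ∩ W
-- and c, d ∈ S ∩ U ∩ W; since ab ∉ G_q, one of a, b, say x, lies outside U.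
-- For y ∈ {c, d} the pair xy is an edge of G_s (from W) not in G_p (from S);
-- it is not in G_q either, as then x ∈ U. So xy ∈ G_k∖G_q and y ∈ T, whence
-- cd ∈ G_k∖G_q, contradicting cd ∈ G_q.

private
  true≢false : true ≢ false
  true≢false ()

module _ {n : ℕ} where

  ∖G-intro : (H G : Graph n) {u v : Fin n} →
             adj H u v ≡ true → adj G u v ≡ false → (H ∖G G) u v ≡ true
  ∖G-intro _ _ h g rewrite h | g = refl

  ∖G-elim : (H G : Graph n) {u v : Fin n} →
            (H ∖G G) u v ≡ true → adj H u v ≡ true × adj G u v ≡ false
  ∖G-elim H G {u} {v} e with adj H u v | adj G u v
  ... | true  | false = refl , refl
  ... | true  | true  = ⊥-elim (true≢false (sym e))
  ... | false | _     = ⊥-elim (true≢false (sym e))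

  ⊆G-trans : (A B C : Graph n) → A ⊆G B → B ⊆G C → A ⊆G C
  ⊆G-trans _ _ _ A⊆B B⊆C u v h = B⊆C u v (A⊆B u v h)

  ⊆G-false : (G H : Graph n) → G ⊆G H → ∀ {u v} → adj H u v ≡ false → adj G u v ≡ false
  ⊆G-false _ _ G⊆H h = ¬-not λ g → true≢false (trans (sym (G⊆H _ _ g)) h)

  ⊆G-byContradiction : (H G : Graph n) →
                       (∀ u v → adj H u v ≡ true → adj G u v ≡ false → ⊥) → H ⊆G G
  ⊆G-byContradiction _ _ noNewEdge u v h = ¬-not (noNewEdge u v h)

  adj⇒≢ : (G : Graph n) {u v : Fin n} → adj G u v ≡ true → u ≢ v
  adj⇒≢ G {u} h refl = true≢false (trans (sym h) (irrefl G u))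

  clique-ends : {E : EdgeSet n} (K : IsClique E) {u v : Fin n} → u ≢ v →
                E u v ≡ true → proj₁ K u ≡ true × proj₁ K v ≡ true
  clique-ends (_ , _ , K) u≢v e = proj₁ (K _ _ u≢v) e

  clique-edge : {E : EdgeSet n} (K : IsClique E) {u v : Fin n} → u ≢ v →
                proj₁ K u ≡ true → proj₁ K v ≡ true → E u v ≡ true
  clique-edge (_ , _ , K) u≢v su sv = proj₂ (K _ _ u≢v) (su , sv)

module FourCliques {n : ℕ} (Gm Gl Gp Gq Gs Gj Gk : Graph n)
  (m⊆p : Gm ⊆G Gp) (l⊆p : Gl ⊆G Gp) (p⊆q : Gp ⊆G Gq) (q⊆s : Gq ⊆G Gs)
  (s⊆j : Gs ⊆G Gj) (s⊆k : Gs ⊆G Gk)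
  (KS : IsClique (Gj ∖G Gp)) (KT : IsClique (Gk ∖G Gq))
  (KU : IsClique (Gq ∖G Gl)) (KW : IsClique (Gs ∖G Gm))
  where

  private
    S T U W : Fin n → Bool
    S = proj₁ KS
    T = proj₁ KT
    U = proj₁ KU
    W = proj₁ KW

    Both : (Fin n → Bool) → Fin n → Fin n → Set
    Both X u v = X u ≡ true × X v ≡ true

    OutsideU : Fin n → Set
    OutsideU x = S x ≡ true × W x ≡ true × U x ≡ false

    top-edge-ends : ∀ {a b} → adj Gs a b ≡ true → adj Gq a b ≡ false →
                    Both S a b × Both T a b × Both W a b
    top-edge-ends {a} {b} ab∈s ab∉q =
        clique-ends KS a≢b (∖G-intro Gj Gp (s⊆j a b ab∈s) (⊆G-false Gp Gq p⊆q ab∉q))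
      , clique-ends KT a≢b (∖G-intro Gk Gq (s⊆k a b ab∈s) ab∉q)
      , clique-ends KW a≢b
          (∖G-intro Gs Gm ab∈s (⊆G-false Gm Gq (⊆G-trans Gm Gp Gq m⊆p p⊆q) ab∉q))
      where
      a≢b : a ≢ b
      a≢b = adj⇒≢ Gs ab∈s

    mid-edge-ends : ∀ {c d} → adj Gq c d ≡ true → adj Gp c d ≡ false →
                    Both S c d × Both U c d × Both W c d
    mid-edge-ends {c} {d} cd∈q cd∉p =
        clique-ends KS c≢d (∖G-intro Gj Gp (s⊆j c d (q⊆s c d cd∈q)) cd∉p)
      , clique-ends KU c≢d (∖G-intro Gq Gl cd∈q (⊆G-false Gl Gp l⊆p cd∉p))
      , clique-ends KW c≢d (∖G-intro Gs Gm (q⊆s c d cd∈q) (⊆G-false Gm Gp m⊆p cd∉p))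
      where
      c≢d : c ≢ d
      c≢d = adj⇒≢ Gq cd∈q

    top-edge-leavesU : ∀ {a b} → adj Gs a b ≡ true → adj Gq a b ≡ false → ∃[ x ] OutsideU x
    top-edge-leavesU {a} {b} ab∈s ab∉q
      with (sa , sb) , _ , (wa , wb) ← top-edge-ends ab∈s ab∉q
         | U a in ua | U b in ub
    ... | false | _     = a , sa , wa , ua
    ... | true  | false = b , sb , wb , ub
    ... | true  | true  = ⊥-elim (true≢false (trans
          (sym (proj₁ (∖G-elim Gq Gl (clique-edge KU (adj⇒≢ Gs ab∈s) ua ub)))) ab∉q))

    OutsideU⇒T : ∀ {x y} → OutsideU x → S y ≡ true → W y ≡ true → U y ≡ true → T y ≡ true
    OutsideU⇒T {x} {y} (sx , wx , ux) sy wy uy =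
      proj₂ (clique-ends KT x≢y (∖G-intro Gk Gq (s⊆k x y xy∈s) xy∉q))
      where
      x≢y : x ≢ y
      x≢y refl = true≢false (trans (sym uy) ux)
      xy∉p : adj Gp x y ≡ false
      xy∉p = proj₂ (∖G-elim Gj Gp (clique-edge KS x≢y sx sy))
      xy∈s : adj Gs x y ≡ true
      xy∈s = proj₁ (∖G-elim Gs Gm (clique-edge KW x≢y wx wy))
      xy∉q : adj Gq x y ≡ false
      xy∉q = ¬-not λ xy∈q → true≢false (trans
        (sym (proj₁ (clique-ends KU x≢y (∖G-intro Gq Gl xy∈q (⊆G-false Gl Gp l⊆p xy∉p))))) ux)

    new-edges-clash : ∀ {a b c d} → adj Gs a b ≡ true → adj Gq a b ≡ false →
                      adj Gq c d ≡ true → adj Gp c d ≡ false → ⊥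
    new-edges-clash {c = c} {d} ab∈s ab∉q cd∈q cd∉p
      with x , x∉U ← top-edge-leavesU ab∈s ab∉q
         | (sc , sd) , (uc , ud) , (wc , wd) ← mid-edge-ends cd∈q cd∉p
      = true≢false (trans (sym cd∈q) (proj₂ (∖G-elim Gk Gq cd∈k∖q)))
      where
      cd∈k∖q : (Gk ∖G Gq) c d ≡ true
      cd∈k∖q = clique-edge KT (adj⇒≢ Gq cd∈q) (OutsideU⇒T x∉U sc wc uc) (OutsideU⇒T x∉U sd wd ud)

  ¬q⊆p⇒s⊆q : ¬ (Gq ⊆G Gp) → Gs ⊆G Gq
  ¬q⊆p⇒s⊆q q⊈p = ⊆G-byContradiction Gs Gq λ a b ab∈s ab∉q →
    q⊈p (⊆G-byContradiction Gq Gp λ c d cd∈q cd∉p → new-edges-clash ab∈s ab∉q cd∈q cd∉p)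

module StrictChain {n : ℕ} (r : ℕ) (G : ℕ → Graph n)
  (strict : ∀ a → 1 ≤ a → a < r → G a ⊊G G (suc a)) where

  ⊆-step : ∀ {a} → 1 ≤ a → a < r → G a ⊆G G (suc a)
  ⊆-step 1≤a a<r = proj₁ (strict _ 1≤a a<r)

  ⊆-mono′ : ∀ {a b} → 1 ≤ a → a ≤′ b → b ≤ r → G a ⊆G G b
  ⊆-mono′ _ ≤′-refl _ u v e = e
  ⊆-mono′ {a} 1≤a (≤′-step {b} a≤′b) b<r =
    ⊆G-trans (G a) (G b) (G (suc b))
      (⊆-mono′ 1≤a a≤′b (<⇒≤ b<r)) (⊆-step (≤-trans 1≤a (≤′⇒≤ a≤′b)) b<r)

  ⊆-mono : ∀ {a b} → 1 ≤ a → a ≤ b → b ≤ r → G a ⊆G G b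
  ⊆-mono 1≤a a≤b = ⊆-mono′ 1≤a (≤⇒≤′ a≤b)

  no-three-cliques : ∀ p → 1 ≤ p → suc (suc p) ≤ r
    → ¬ ( (∃[ j ] (suc p < j × j ≤ r × IsClique (G j ∖G G p)))
        × (∃[ k ] ∃[ l ] (suc p < k × k ≤ r × 1 ≤ l × l < suc p
             × IsClique (G k ∖G G (suc p))
             × IsClique (G (suc p) ∖G G l)))
        × (∃[ m ] (1 ≤ m × m < suc p × IsClique (G (suc (suc p)) ∖G G m))) )
  no-three-cliques p 1≤p s≤r
    ((j , s≤j , j≤r , KS) , (k , l , s≤k , k≤r , 1≤l , l<q , KT , KU) , (m , 1≤m , m<q , KW)) =
    proj₂ (strict (suc p) z<s s≤r) (¬q⊆p⇒s⊆q (proj₂ (strict p 1≤p q≤r)))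
    where
    q≤r : suc p ≤ r
    q≤r = <⇒≤ s≤r
    open FourCliques (G m) (G l) (G p) (G (suc p)) (G (suc (suc p))) (G j) (G k)
                 (⊆-mono 1≤m (<⇒≤pred m<q) (<⇒≤ q≤r)) (⊆-mono 1≤l (<⇒≤pred l<q) (<⇒≤ q≤r))
                 (⊆-step 1≤p q≤r) (⊆-step z<s s≤r)
                 (⊆-mono z<s s≤j j≤r) (⊆-mono z<s s≤k k≤r)
                 KS KT KU KW

lemma3 : ∀ {n} (r : ℕ) (G : ℕ → Graph n)
    → (∀ a → 1 ≤ a → a < r → G a ⊊G G (suc a))
    → (i : ℕ) → 1 ≤ i → 3 * i ≤ r
    → ¬ ( (∃[ j ] (3 * i ∸ 1 < j × j ≤ r × IsClique (G j ∖G G (3 * i ∸ 2))))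
        × (∃[ k ] ∃[ l ] (3 * i ∸ 1 < k × k ≤ r × 1 ≤ l × l < 3 * i ∸ 1
             × IsClique (G k ∖G G (3 * i ∸ 1))
             × IsClique (G (3 * i ∸ 1) ∖G G l)))
        × (∃[ m ] (1 ≤ m × m < 3 * i ∸ 1 × IsClique (G (3 * i) ∖G G m))) )
lemma3 r G strict i 1≤i 3i≤r with 3 * i | *-monoʳ-≤ 3 1≤i
... | suc (suc (suc p)) | s≤s (s≤s (s≤s _)) =
  StrictChain.no-three-cliques r G strict (suc p) z<s 3i≤r
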